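{- Consider a stable matching instance with fixed preferences, men $m_1,\dots,m_M$, and men-optimal stable matching $\mu_{\mathcal M}$. Let $n$ be such that $m_n$ is matched in $\mu_{\mathcal M}$, and set $w_n=\mu_{\mathcal M}(m_n)$. Let $0\le l<n\le r\le M$ be such that $\{m_1,\dots,m_l\}$ and $\{m_1,\dots,m_r\}$ are separators. Let \[x=\big|\{i\le l:\ \exists j>l,\ m_j\succ_{w_n}m_i\succ_{w_n}m_n\}\big|.\] Then, in $w_n$'s preference list, the difference of ranks between her worst and her best stable partners is at most $x+r-l-1$.
   Context: A matching is stable if no man–woman pair prefer each other to their partners and no one is matched to an unacceptable partner. A stable partner of $w$ is a man matched to her in some stable matching. $\mu_{\mathcal M}$ is the stable matching in which each man has his best and each woman her worst stable partner. A set $S\subseteq\mathcal M$ is a separator if every woman matched in $\mu_{\mathcal M}$ to a man of $S$ prefers her $\mu_{\mathcal M}$-partner to every man outside $S$. -}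

module Defs where

open import Data.Nat using (ℕ; zero; suc; _<_; _≤_; _<ᵇ_; _≤ᵇ_)
open import Data.Fin using (Fin; toℕ; _≟_)
open import Data.Fin.Properties using ()
open import Data.List using (List; []; _∷_; length; filterᵇ; allFin)
open import Data.Bool.ListAction using (any)
open import Data.List.Relation.Unary.Unique.Propositional using (Unique)
open import Data.Maybe using (Maybe; just; nothing)
open import Data.Bool using (Bool; _∧_)
import Data.Empty
open import Data.Product using (Σ; ∃; _×_)
open import Relation.Nullary using (yes; no)
open import Relation.Binary.PropositionalEquality using (_≡_)

-- Position (0-based rank) of an element in a preference list; an element
-- not in the list (unacceptable) gets rank = length of the list.
pos : {n : ℕ} → List (Fin n) → Fin n → ℕ
pos [] a = 0
pos (b ∷ bs) a with a ≟ b
... | yes _ = 0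
... | no _ = suc (pos bs a)

-- Rank of an optional partner; being unmatched ranks after all acceptable ones.
posM : {n : ℕ} → List (Fin n) → Maybe (Fin n) → ℕ
posM L (just a) = pos L a
posM L nothing = length L

Acceptable : {n : ℕ} → List (Fin n) → Fin n → Set
Acceptable L a = pos L a < length L

-- A stable matching instance: men Fin M (m_1 … m_M are indices 0 … M-1),
-- women Fin W, each agent with a strict preference list over acceptable
-- partners (most preferred first, no repetitions).
record Instance (M W : ℕ) : Set where
  field
    prefM : Fin M → List (Fin W)
    prefW : Fin W → List (Fin M)
    uniqueM : (m : Fin M) → Unique (prefM m)
    uniqueW : (w : Fin W) → Unique (prefW w)

module _ {M W : ℕ} (I : Instance M W) where
  open Instance I

  _≻[_]_ : Fin M → Fin W → Fin M → Set
  a ≻[ w ] b = pos (prefW w) a < pos (prefW w) b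

  _≻[_]ᵇ_ : Fin M → Fin W → Fin M → Bool
  a ≻[ w ]ᵇ b = pos (prefW w) a <ᵇ pos (prefW w) b

  record Matching : Set where
    field
      μ : Fin M → Maybe (Fin W)
      inj : ∀ {m m' w} → μ m ≡ just w → μ m' ≡ just w → m ≡ m'
  open Matching public

  WomanPrefers : Matching → Fin W → Fin M → Set
  WomanPrefers ν w m =
    Acceptable (prefW w) m × (∀ m' → μ ν m' ≡ just w → m ≻[ w ] m')

  ManPrefers : Matching → Fin M → Fin W → Set
  ManPrefers ν m w = pos (prefM m) w < posM (prefM m) (μ ν m)

  record Stable (ν : Matching) : Set where
    field
      rational : ∀ m w → μ ν m ≡ just w →
                 Acceptable (prefM m) w × Acceptable (prefW w) m
      noBlock : ∀ m w → ManPrefers ν m w → WomanPrefers ν w m → Data.Empty.⊥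

  StablePartner : Fin W → Fin M → Set
  StablePartner w m = Σ Matching λ ν → Stable ν × μ ν m ≡ just w

  record MenOptimal (μM : Matching) : Set where
    field
      stable : Stable μM
      best : ∀ (ν : Matching) → Stable ν → ∀ m →
             posM (prefM m) (μ μM m) ≤ posM (prefM m) (μ ν m)

  -- The set {m_1, …, m_k} = {men with index < k}
  InFirst : ℕ → Fin M → Set
  InFirst k m = toℕ m < k

  Separator : Matching → (Fin M → Set) → Set
  Separator μM S = ∀ m w → S m → μ μM m ≡ just w →
                   ∀ m' → (S m' → Data.Empty.⊥) → m ≻[ w ] m'

  -- x = |{ i ≤ l : ∃ j > l, m_j ≻_w m_i ≻_w m_n }|  (1-based indices in the paper)
  countX : Fin W → ℕ → Fin M → ℕ
  countX w l n = length (filterᵇ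
    (λ i → (suc (toℕ i) ≤ᵇ l)
           ∧ any (λ j → (l ≤ᵇ toℕ j) ∧ (j ≻[ w ]ᵇ i)) (allFin M)
           ∧ (i ≻[ w ]ᵇ n))
    (allFin M))

-- Women are matched to their worst stable partner in μM, so the worst stable
-- partner of wn is ranked no better than mn.  A separator S is respected by
-- every stable matching ν: sending a man of S to the ν-partner of his
-- μM-partner permutes the men of S that ν displaces, so the ν-partner of a man
-- of S is the μM-partner of a man of S.  Hence the best stable partner b of wn
-- lies outside {m1, …, ml}.  Every man ranked by wn from b up to (excluding) mn
-- lies in {m1, …, mr}; those outside {m1, …, ml} are among the r − l − 1 men
-- other than mn, and those inside are outranked by b, so are counted by x.

module Submission where

open import Defs
open import Data.Nat using (ℕ; _≤_; _<_; _+_; _∸_)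
open import Data.Fin using (Fin; toℕ)
open import Data.Maybe using (just)
open import Relation.Binary.PropositionalEquality using (_≡_)

open import Data.Nat using (zero; suc; z≤n; s≤s; s≤s⁻¹; _⊓_; _≤ᵇ_)
open import Data.Nat.Properties
open import Data.Nat.GeneralisedArithmetic using (fold)
open import Data.Fin using () renaming (_≟_ to _≟ᶠ_; _<_ to _<ᶠ_)
open import Data.Fin.Properties using (toℕ-injective; pigeonhole; ¬∀⟶∃¬)
open import Data.Maybe using (Maybe; nothing)
open import Data.Maybe.Properties using (just-injective; ≡-dec)
open import Data.List using (List; []; _∷_; length; take; drop; map; applyUpTo; _++_; [_]; filterᵇ; allFin)
open import Data.List.Properties using (length-take; length-drop; length-map; length-applyUpTo; length-++)
open import Data.List.Membership.Propositional using (_∈_; lose)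
open import Data.List.Membership.Propositional.Properties
  using (∈-∃++; ∈-++⁻; ∈-++⁺ˡ; ∈-++⁺ʳ; ∈-map⁺; ∈-map⁻; ∈-applyUpTo⁺; ∈-filter⁺; ∈-allFin)
open import Data.List.Relation.Unary.Any using (here; there)
open import Data.List.Relation.Unary.Any.Properties using (any⁺)
open import Data.List.Relation.Unary.All using (lookup)
open import Data.List.Relation.Unary.AllPairs using ([]; _∷_)
open import Data.List.Relation.Unary.Unique.Propositional using (Unique)
open import Data.List.Relation.Unary.Unique.Propositional.Properties using (map⁺; take⁺; drop⁺)
open import Data.List.Relation.Binary.Sublist.Propositional using () renaming (lookup to lookup-⊆)
open import Data.List.Relation.Binary.Sublist.Propositional.Properties using (take-⊆; drop-⊆)
open import Data.Bool using (Bool; T; _∧_)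
open import Data.Bool.Properties using (T-∧)
open import Data.Bool.ListAction using (any)
open import Data.Product using (Σ; ∃; ∃₂; _×_; _,_; proj₁; proj₂)
open import Data.Sum using (inj₁; inj₂)
open import Data.Empty using (⊥-elim)
open import Function.Base using (_∘_)
open import Function.Bundles using (Equivalence)
open import Relation.Nullary using (¬_; yes; no; Dec; contradiction)
open import Relation.Nullary.Decidable using (_→-dec_; T?)
open import Relation.Unary using (Decidable)
open import Relation.Binary using (tri<; tri≈; tri>)
open import Relation.Binary.PropositionalEquality using (_≢_; refl; sym; trans; cong; cong₂; subst; module ≡-Reasoning)

pos-injective : {k : ℕ} (L : List (Fin k)) {a b : Fin k} →
                pos L a < length L → pos L a ≡ pos L b → a ≡ b
pos-injective (c ∷ cs) {a} {b} a<len e with a ≟ᶠ c | b ≟ᶠ c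
... | yes a≡c | yes b≡c = trans a≡c (sym b≡c)
... | yes _   | no _    = contradiction e 0≢1+n
... | no _    | yes _   = contradiction (sym e) 0≢1+n
... | no _    | no _    = pos-injective cs (s≤s⁻¹ a<len) (suc-injective e)

between : {A : Set} → List A → ℕ → ℕ → List A
between L a b = take (b ∸ a) (drop a L)

length-between : {A : Set} (L : List A) (a b : ℕ) → b ≤ length L → length (between L a b) ≡ b ∸ a
length-between L a b b≤len = begin
  length (take (b ∸ a) (drop a L))   ≡⟨ length-take (b ∸ a) (drop a L) ⟩
  (b ∸ a) ⊓ length (drop a L)        ≡⟨ cong ((b ∸ a) ⊓_) (length-drop a L) ⟩
  (b ∸ a) ⊓ (length L ∸ a)           ≡⟨ m≤n⇒m⊓n≡m (∸-monoˡ-≤ a b≤len) ⟩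
  b ∸ a                              ∎
  where open ≡-Reasoning

∈-take⇒pos< : {n : ℕ} {x : Fin n} (k : ℕ) (L : List (Fin n)) → x ∈ take k L → pos L x < k
∈-take⇒pos< {x = x} (suc k) (c ∷ cs) x∈ with x ≟ᶠ c | x∈
... | yes _ | _          = s≤s z≤n
... | no x≢c | here x≡c  = contradiction x≡c x≢c
... | no _  | there x∈cs = s≤s (∈-take⇒pos< k cs x∈cs)

∈-take-drop⇒pos : {n : ℕ} {x : Fin n} (a k : ℕ) (L : List (Fin n)) → Unique L →
                  x ∈ take k (drop a L) → a ≤ pos L x × pos L x < a + k
∈-take-drop⇒pos zero k L _ x∈ = z≤n , ∈-take⇒pos< k L x∈
∈-take-drop⇒pos (suc a) k [] _ x∈ with () ← lookup-⊆ (take-⊆ k []) x∈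
∈-take-drop⇒pos {x = x} (suc a) k (c ∷ cs) (c∉cs ∷ uniq) x∈ with x ≟ᶠ c
... | yes x≡c = contradiction (sym x≡c) (lookup c∉cs (lookup-⊆ (drop-⊆ a cs) (lookup-⊆ (take-⊆ k _) x∈)))
... | no _ with ∈-take-drop⇒pos a k cs uniq x∈
...   | a≤pos , pos<a+k = s≤s a≤pos , s≤s pos<a+k

∈-between⇒pos : {n : ℕ} {x : Fin n} (L : List (Fin n)) (a b : ℕ) → Unique L →
                x ∈ between L a b → a ≤ pos L x × pos L x < b
∈-between⇒pos {x = x} L a b uniq x∈ with ∈-take-drop⇒pos a (b ∸ a) L uniq x∈ | ≤-total a b
... | a≤pos , pos< | inj₁ a≤b = a≤pos , subst (pos L x <_) (m+[n∸m]≡n a≤b) pos<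
... | a≤pos , pos< | inj₂ b≤a =
  contradiction (subst (pos L x <_) (trans (cong (a +_) (m≤n⇒m∸n≡0 b≤a)) (+-identityʳ a)) pos<) (≤⇒≯ a≤pos)

Unique-⊆⇒length≤ : {A : Set} (xs ys : List A) → Unique xs → (∀ {y} → y ∈ xs → y ∈ ys) →
                   length xs ≤ length ys
Unique-⊆⇒length≤ [] ys _ _ = z≤n
Unique-⊆⇒length≤ (x ∷ xs) ys (x∉xs ∷ uniq) xs⊆ys with ∈-∃++ (xs⊆ys (here refl))
... | us , vs , refl = begin
  suc (length xs)              ≤⟨ s≤s (Unique-⊆⇒length≤ xs (us ++ vs) uniq xs⊆us++vs) ⟩
  suc (length (us ++ vs))      ≡⟨ cong suc (length-++ us) ⟩
  suc (length us + length vs)  ≡⟨ +-suc (length us) (length vs) ⟨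
  length us + suc (length vs)  ≡⟨ length-++ us ⟨
  length (us ++ [ x ] ++ vs)   ∎
  where
  open ≤-Reasoning
  xs⊆us++vs : ∀ {y} → y ∈ xs → y ∈ us ++ vs
  xs⊆us++vs y∈xs with ∈-++⁻ us (xs⊆ys (there y∈xs))
  ... | inj₁ y∈us          = ∈-++⁺ˡ y∈us
  ... | inj₂ (here y≡x)    = contradiction (sym y≡x) (lookup x∉xs y∈xs)
  ... | inj₂ (there y∈vs)  = ∈-++⁺ʳ us y∈vs

-- By pigeonhole the orbit of a repeats a key; injectivity pulls the
-- repetition back to the key of a itself.
key-surjective : {A : Set} {k : ℕ} (key : A → Fin k) (f : A → A) →
                 (∀ a a′ → key (f a) ≡ key (f a′) → key a ≡ key a′) →
                 ∀ a → ∃ λ a′ → key (f a′) ≡ key a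
key-surjective {A} {k} key f f-injective a = returns (pigeonhole (n<1+n k) (λ t → key (orbit (toℕ t))))
  where
  orbit : ℕ → A
  orbit = fold a f
  back : ∀ t d → key (orbit t) ≡ key (orbit (t + d)) → key a ≡ key (orbit d)
  back zero    d eq = eq
  back (suc t) d eq = back t d (f-injective _ _ eq)
  returns : ∃₂ (λ i j → i <ᶠ j × key (orbit (toℕ i)) ≡ key (orbit (toℕ j))) → ∃ λ a′ → key (f a′) ≡ key a
  returns (i , j , i<j , same) with d , i+1+d≡j ← m≤n⇒∃[o]m+o≡n i<j =
    orbit d , sym (back (toℕ i) (suc d) (trans same (cong (λ t → key (orbit t)) (trans (sym i+1+d≡j) (sym (+-suc (toℕ i) d))))))

range-without-point : {l n r : ℕ} → l ≤ n → n < r → (n ∸ l) + (r ∸ suc n) ≡ r ∸ l ∸ 1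
range-without-point {l} l≤n n<r
  with a , refl ← m≤n⇒∃[o]m+o≡n l≤n
  with b , refl ← m≤n⇒∃[o]m+o≡n n<r = begin
  (l + a ∸ l) + (suc (l + a) + b ∸ suc (l + a))  ≡⟨ cong₂ _+_ (m+n∸m≡n l a) (m+n∸m≡n (suc (l + a)) b) ⟩
  a + b                                          ≡⟨ cong (_∸ 1) (m+n∸m≡n l (suc (a + b))) ⟨
  l + suc (a + b) ∸ l ∸ 1                        ≡⟨ cong (λ t → t ∸ l ∸ 1) (+-suc l (a + b)) ⟩
  suc (l + (a + b)) ∸ l ∸ 1                      ≡⟨ cong (λ t → suc t ∸ l ∸ 1) (+-assoc l a b) ⟨
  suc (l + a) + b ∸ l ∸ 1                        ∎
  where open ≡-Reasoning

posM≤acceptable⇒just : {k : ℕ} (L : List (Fin k)) {a : Fin k} (x : Maybe (Fin k)) →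
                       posM L x ≤ pos L a → pos L a < length L → ∃ λ b → x ≡ just b
posM≤acceptable⇒just L nothing  x≤a a<len = contradiction x≤a (<⇒≱ a<len)
posM≤acceptable⇒just L (just b) _   _     = b , refl

acceptable-≤posM⇒<posM : {k : ℕ} (L : List (Fin k)) {a : Fin k} (x : Maybe (Fin k)) →
                         pos L a < length L → pos L a ≤ posM L x → x ≢ just a → pos L a < posM L x
acceptable-≤posM⇒<posM L nothing  a<len _   _   = a<len
acceptable-≤posM⇒<posM L (just b) a<len a≤b b≢a =
  ≤∧≢⇒< a≤b (λ a≡b → b≢a (cong just (pos-injective L (subst (_< length L) a≡b a<len) (sym a≡b))))

module MenOptimalMatching {M W : ℕ} (I : Instance M W) (μM : Matching I) (μM-optimal : MenOptimal I μM) where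
  open Instance I
  open MenOptimal μM-optimal

  module _ {ν : Matching I} (ν-stable : Stable I ν) where

    μM-partner-≤ : ∀ {m w} → μ μM m ≡ just w → pos (prefM m) w ≤ posM (prefM m) (μ ν m)
    μM-partner-≤ {m} μMm≡w = subst (λ x → posM (prefM m) x ≤ posM (prefM m) (μ ν m)) μMm≡w (best ν ν-stable m)

    ν-partner-≥ : ∀ {m w} → μ ν m ≡ just w → posM (prefM m) (μ μM m) ≤ pos (prefM m) w
    ν-partner-≥ {m} νm≡w = subst (λ x → posM (prefM m) (μ μM m) ≤ posM (prefM m) x) νm≡w (best ν ν-stable m)

    ν-matched⇒μM-matched : ∀ {m w} → μ ν m ≡ just w → ∃ λ w′ → μ μM m ≡ just w′
    ν-matched⇒μM-matched {m} {w} νm≡w =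
      posM≤acceptable⇒just (prefM m) (μ μM m) (ν-partner-≥ νm≡w) (proj₁ (Stable.rational ν-stable m w νm≡w))

    prefers-μM-partner : ∀ {m w} → μ μM m ≡ just w → μ ν m ≢ just w → ManPrefers I ν m w
    prefers-μM-partner {m} {w} μMm≡w νm≢w =
      acceptable-≤posM⇒<posM (prefM m) (μ ν m) (proj₁ (Stable.rational stable m w μMm≡w)) (μM-partner-≤ μMm≡w) νm≢w

    μM-women-pessimal : ∀ {m n w} → μ μM n ≡ just w → μ ν m ≡ just w → pos (prefW w) m ≤ pos (prefW w) n
    μM-women-pessimal {m} {n} {w} μMn≡w νm≡w with pos (prefW w) n <? pos (prefW w) m
    ... | no  n≮m = ≮⇒≥ n≮m
    ... | yes n<m = ⊥-elim (Stable.noBlock ν-stable n w n-prefers-w (proj₂ (Stable.rational stable n w μMn≡w) , w-prefers-n))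
      where
      ν-partner-of-w : ∀ {m′} → μ ν m′ ≡ just w → m′ ≡ m
      ν-partner-of-w νm′≡w = Matching.inj ν νm′≡w νm≡w
      n-prefers-w : ManPrefers I ν n w
      n-prefers-w = prefers-μM-partner μMn≡w (λ νn≡w → <-irrefl (cong (pos (prefW w)) (ν-partner-of-w νn≡w)) n<m)
      w-prefers-n : ∀ m′ → μ ν m′ ≡ just w → pos (prefW w) n < pos (prefW w) m′
      w-prefers-n m′ νm′≡w rewrite ν-partner-of-w νm′≡w = n<m

    rematched : ∀ {m w} → μ μM m ≡ just w → μ ν m ≢ just w →
                ∃ λ m′ → μ ν m′ ≡ just w × ¬ (pos (prefW w) m < pos (prefW w) m′)
    rematched {m} {w} μMm≡w νm≢w with ¬∀⟶∃¬ M _ w-prefers-m? w-not-prefers-m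
      where
      w-prefers-m? : ∀ m′ → Dec (μ ν m′ ≡ just w → pos (prefW w) m < pos (prefW w) m′)
      w-prefers-m? m′ = ≡-dec _≟ᶠ_ (μ ν m′) (just w) →-dec (pos (prefW w) m <? pos (prefW w) m′)
      w-not-prefers-m : ¬ (∀ m′ → μ ν m′ ≡ just w → pos (prefW w) m < pos (prefW w) m′)
      w-not-prefers-m prefers = Stable.noBlock ν-stable m w (prefers-μM-partner μMm≡w νm≢w)
                                  (proj₂ (Stable.rational stable m w μMm≡w) , prefers)
    ... | m′ , not-implied with ≡-dec _≟ᶠ_ (μ ν m′) (just w)
    ...   | yes νm′≡w = m′ , νm′≡w , λ m≻m′ → not-implied (λ _ → m≻m′)
    ...   | no  νm′≢w = contradiction (λ νm′≡w → contradiction νm′≡w νm′≢w) not-implied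

    module _ (S : Fin M → Set) (S? : Decidable S) (S-separator : Separator I μM S) where

      Displaced : Fin M → Set
      Displaced m = S m × ∃ λ w → μ μM m ≡ just w × μ ν m ≢ just w

      displaced-successor : ∀ {m} → Displaced m → ∃ λ m′ → Displaced m′ × μ ν m′ ≡ μ μM m
      displaced-successor {m} (m∈S , w , μMm≡w , νm≢w) with rematched μMm≡w νm≢w
      ... | m′ , νm′≡w , m⊁m′ with ν-matched⇒μM-matched νm′≡w
      ...   | w′ , μMm′≡w′ = m′ , (m′∈S , w′ , μMm′≡w′ , νm′≢w′) , trans νm′≡w (sym μMm≡w)
        where
        m′∈S : S m′
        m′∈S with S? m′
        ... | yes m′∈S = m′∈S
        ... | no  m′∉S = contradiction (S-separator m w m∈S μMm≡w m′ m′∉S) m⊁m′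
        νm′≢w′ : μ ν m′ ≢ just w′
        νm′≢w′ νm′≡w′ with refl ← just-injective (trans (sym νm′≡w) νm′≡w′)
                      with refl ← Matching.inj μM μMm≡w μMm′≡w′ = νm≢w νm′≡w

      next : Σ (Fin M) Displaced → Σ (Fin M) Displaced
      next (m , d) = proj₁ (displaced-successor d) , proj₁ (proj₂ (displaced-successor d))

      next-injective : ∀ d d′ → proj₁ (next d) ≡ proj₁ (next d′) → proj₁ d ≡ proj₁ d′
      next-injective (m , d) (m′ , d′) same = Matching.inj μM (proj₁ (proj₂ (proj₂ d))) (begin
        μ μM m′                              ≡⟨ proj₂ (proj₂ (displaced-successor d′)) ⟨
        μ ν (proj₁ (displaced-successor d′)) ≡⟨ cong (μ ν) same ⟨
        μ ν (proj₁ (displaced-successor d))  ≡⟨ proj₂ (proj₂ (displaced-successor d)) ⟩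
        μ μM m                               ≡⟨ proj₁ (proj₂ (proj₂ d)) ⟩
        just _                               ∎)
        where open ≡-Reasoning

      separator-respected : ∀ {m m′ w} → S m → μ ν m ≡ just w → μ μM m′ ≡ just w → S m′
      separator-respected {m} {m′} {w} m∈S νm≡w μMm′≡w with ν-matched⇒μM-matched νm≡w
      ... | w₀ , μMm≡w₀ with ≡-dec _≟ᶠ_ (μ ν m) (just w₀)
      ...   | yes νm≡w₀ = subst S (Matching.inj μM (trans μMm≡w₀ (trans (sym νm≡w₀) νm≡w)) μMm′≡w) m∈S
      ...   | no  νm≢w₀ with key-surjective proj₁ next next-injective (m , m∈S , w₀ , μMm≡w₀ , νm≢w₀)
      ...     | (m″ , d″) , m″-to-m = subst S (Matching.inj μM μMm″≡w μMm′≡w) (proj₁ d″)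
        where
        μMm″≡w : μ μM m″ ≡ just w
        μMm″≡w = trans (sym (proj₂ (proj₂ (displaced-successor d″)))) (trans (cong (μ ν) m″-to-m) νm≡w)

module _ {M W : ℕ} (I : Instance M W) (μM : Matching I) {wn : Fin W} {n : Fin M} {l r : ℕ} where
  open Instance I

  -- Literally the predicate filtered in countX, so that filtering with it has length countX by computation.
  counted : Fin M → Bool
  counted i = (suc (toℕ i) ≤ᵇ l)
            ∧ any (λ j → (l ≤ᵇ toℕ j) ∧ (_≻[_]ᵇ_ I j wn i)) (allFin M)
            ∧ (_≻[_]ᵇ_ I i wn n)

  counted-indices lower-indices upper-indices candidates : List ℕ
  counted-indices = map toℕ (filterᵇ counted (allFin M))
  lower-indices   = applyUpTo (l +_) (toℕ n ∸ l)
  upper-indices   = applyUpTo (suc (toℕ n) +_) (r ∸ suc (toℕ n))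
  candidates      = counted-indices ++ lower-indices ++ upper-indices

  length-candidates : l ≤ toℕ n → toℕ n < r → length candidates ≡ countX I wn l n + r ∸ l ∸ 1
  length-candidates l≤n n<r = begin
    length candidates                                          ≡⟨ length-++ counted-indices ⟩
    length counted-indices + length (lower-indices ++ upper-indices)
      ≡⟨ cong₂ _+_ (length-map toℕ (filterᵇ counted (allFin M))) (length-++ lower-indices) ⟩
    x + (length lower-indices + length upper-indices)
      ≡⟨ cong (x +_) (cong₂ _+_ (length-applyUpTo (l +_) (toℕ n ∸ l)) (length-applyUpTo (suc (toℕ n) +_) (r ∸ suc (toℕ n)))) ⟩
    x + ((toℕ n ∸ l) + (r ∸ suc (toℕ n)))            ≡⟨ cong (x +_) (range-without-point l≤n n<r) ⟩
    x + (r ∸ l ∸ 1)                                  ≡⟨ +-∸-assoc x (m<n⇒0<n∸m (≤-<-trans l≤n n<r)) ⟨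
    x + (r ∸ l) ∸ 1                                  ≡⟨ cong (_∸ 1) (+-∸-assoc x (<⇒≤ (≤-<-trans l≤n n<r))) ⟨
    x + r ∸ l ∸ 1                                    ∎
    where
    open ≡-Reasoning
    x : ℕ
    x = countX I wn l n

  module _ (l≤n : l ≤ toℕ n) (n<r : toℕ n < r) (μMn≡wn : μ μM n ≡ just wn) (n-acceptable : Acceptable (prefW wn) n)
           (r-separator : Separator I μM (InFirst I r)) {b : Fin M} (l≤b : l ≤ toℕ b) where

    private
      L : List (Fin M)
      L = prefW wn

    ranked-between⇒candidate : ∀ {m} → pos L b ≤ pos L m → pos L m < pos L n → toℕ m ∈ candidates
    ranked-between⇒candidate {m} b≤m m<n with toℕ m <? r
    ... | no m≮r = contradiction (r-separator n wn n<r μMn≡wn m m≮r) (<⇒≯ m<n)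
    ... | yes m<r with toℕ m <? l
    ...   | yes m<l = ∈-++⁺ˡ (∈-map⁺ toℕ (∈-filter⁺ (T? ∘ counted) (∈-allFin m) m-counted))
      where
      T-∧⁺ : ∀ {x y} → T x → T y → T (x ∧ y)
      T-∧⁺ tx ty = Equivalence.from T-∧ (tx , ty)
      b≢m : b ≢ m
      b≢m refl = <⇒≱ m<l l≤b
      b<m : pos L b < pos L m
      b<m = ≤∧≢⇒< b≤m (λ b≡m → b≢m (pos-injective L (≤-<-trans b≤m (<-trans m<n n-acceptable)) b≡m))
      m-counted : T (counted m)
      m-counted = T-∧⁺ (≤⇒≤ᵇ m<l) (T-∧⁺ (any⁺ _ (lose (∈-allFin b) (T-∧⁺ (≤⇒≤ᵇ l≤b) (<⇒<ᵇ b<m)))) (<⇒<ᵇ m<n))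
    ...   | no m≮l with <-cmp (toℕ m) (toℕ n)
    ...     | tri< m<n′ _ _ = ∈-++⁺ʳ counted-indices (∈-++⁺ˡ (subst (_∈ lower-indices) (m+[n∸m]≡n (≮⇒≥ m≮l))
                                                                    (∈-applyUpTo⁺ (l +_) (∸-monoˡ-< m<n′ (≮⇒≥ m≮l)))))
    ...     | tri≈ _ m≡n _  = contradiction (cong (pos L) (toℕ-injective m≡n)) (<⇒≢ m<n)
    ...     | tri> _ _ n<m  = ∈-++⁺ʳ counted-indices (∈-++⁺ʳ lower-indices (subst (_∈ upper-indices) (m+[n∸m]≡n n<m)
                                                                         (∈-applyUpTo⁺ (suc (toℕ n) +_) (∸-monoˡ-< m<r n<m))))

    rank-gap≤countX : pos L n ∸ pos L b ≤ countX I wn l n + r ∸ l ∸ 1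
    rank-gap≤countX = begin
      pos L n ∸ pos L b                     ≡⟨ length-between L (pos L b) (pos L n) (<⇒≤ n-acceptable) ⟨
      length (between L (pos L b) (pos L n)) ≡⟨ length-map toℕ (between L (pos L b) (pos L n)) ⟨
      length (map toℕ (between L (pos L b) (pos L n)))
        ≤⟨ Unique-⊆⇒length≤ _ candidates unique-between between⊆candidates ⟩
      length candidates                     ≡⟨ length-candidates l≤n n<r ⟩
      countX I wn l n + r ∸ l ∸ 1           ∎
      where
      open ≤-Reasoning
      unique-between : Unique (map toℕ (between L (pos L b) (pos L n)))
      unique-between = map⁺ toℕ-injective (take⁺ (pos L n ∸ pos L b) (drop⁺ (pos L b) (uniqueW wn)))
      between⊆candidates : ∀ {i} → i ∈ map toℕ (between L (pos L b) (pos L n)) → i ∈ candidates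
      between⊆candidates i∈ with m , m∈ , refl ← ∈-map⁻ toℕ i∈
                            with b≤m , m<n ← ∈-between⇒pos L (pos L b) (pos L n) (uniqueW wn) m∈ =
        ranked-between⇒candidate b≤m m<n

lemma3 : {M W : ℕ} (I : Instance M W) (μM : Matching I) → MenOptimal I μM →
         (n : Fin M) (wn : Fin W) → μ μM n ≡ just wn →
         (l r : ℕ) → l ≤ toℕ n → toℕ n < r → r ≤ M →
         Separator I μM (InFirst I l) → Separator I μM (InFirst I r) →
         (best worst : Fin M) → StablePartner I wn best → StablePartner I wn worst →
         pos (Instance.prefW I wn) worst ∸ pos (Instance.prefW I wn) best
           ≤ countX I wn l n + r ∸ l ∸ 1
lemma3 {M} I μM μM-optimal n wn μMn≡wn l r l≤n n<r _ l-separator r-separator best worst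
       (νb , νb-stable , νb-best≡wn) (νw , νw-stable , νw-worst≡wn) = begin
  pos L worst ∸ pos L best         ≤⟨ ∸-monoˡ-≤ (pos L best) (μM-women-pessimal νw-stable μMn≡wn νw-worst≡wn) ⟩
  pos L n ∸ pos L best             ≤⟨ rank-gap≤countX I μM l≤n n<r μMn≡wn n-acceptable r-separator l≤best ⟩
  countX I wn l n + r ∸ l ∸ 1      ∎
  where
  open ≤-Reasoning
  open MenOptimalMatching I μM μM-optimal
  L : List (Fin M)
  L = Instance.prefW I wn
  n-acceptable : Acceptable L n
  n-acceptable = proj₂ (Stable.rational (MenOptimal.stable μM-optimal) n wn μMn≡wn)
  l≤best : l ≤ toℕ best
  l≤best = ≮⇒≥ λ best<l → <⇒≱ (separator-respected νb-stable (InFirst I l) (λ m → toℕ m <? l) l-separator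
                                                    best<l νb-best≡wn μMn≡wn) l≤n
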